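{- Let $T$ be a triangulation of a convex polyomino. Then $T$ is $3$-colorable if and only if $T$ does not contain an induced subgraph isomorphic to a graph in $S$, where $S$ is the set of the eight graphs obtained by rotating $T_1$ and $T_2$ (drawn in the plane as described below) by multiples of $90^\circ$.
   Context: A polyomino is a plane figure formed by joining finitely many equal unit squares edge to edge, regarded as a graph whose vertices are the corners of its squares and whose edges are the sides of its squares. It is convex if its intersection with every vertical line and with every horizontal line is convex (connected). A triangulation of a polyomino is obtained by adding, in each unit square of the polyomino, exactly one of its two diagonals as an edge. $T_1$ and $T_2$ are triangulations of the $3\times3$ grid graph with vertices $1,\dots,9$ placed as rows $1,2,3$ / $4,5,6$ / $7,8,9$ (top to bottom, left to right), grid edges $\{1,2\},\{2,3\},\{4,5\},\{5,6\},\{7,8\},\{8,9\},\{1,4\},\{4,7\},\{2,5\},\{5,8\},\{3,6\},\{6,9\}$; $T_1$ additionally has diagonals $\{5,7\},\{2,4\},\{6,8\},\{2,6\}$ and $T_2$ additionally has diagonals $\{4,8\},\{1,5\},\{5,9\},\{3,5\}$. A graph is $3$-colorable if its vertices can be colored with at most $3$ colors so that adjacent vertices receive different colors. -}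

module Defs where

open import Data.Nat using (ℕ; zero; suc; _≤_)
open import Data.Fin using (Fin; #_)
import Data.Fin
open import Data.Bool using (Bool; true; false)
open import Data.List using (List; []; _∷_; map)
open import Data.List.Membership.Propositional using (_∈_)
open import Data.Product using (_×_; _,_; Σ; ∃; ∃-syntax)
open import Data.Sum using (_⊎_)
open import Relation.Binary.PropositionalEquality using (_≡_; _≢_)
open import Relation.Binary.Construct.Closure.ReflexiveTransitive using (Star)
open import Relation.Nullary using (¬_)
open import Function.Definitions using (Injective)
open import Function.Bundles using (_⇔_)

-- Lattice points and unit cells.
-- A point is (x , y).  The cell (x , y) is the unit square
-- [x, x+1] × [y, y+1]; its corners are (x,y), (x+1,y), (x,y+1), (x+1,y+1).

Point : Set
Point = ℕ × ℕ

Cell : Set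
Cell = ℕ × ℕ

corners : Cell → List Point
corners (x , y) = (x , y) ∷ (suc x , y) ∷ (x , suc y) ∷ (suc x , suc y) ∷ []

EdgeAdjacentCells : Cell → Cell → Set
EdgeAdjacentCells (x , y) (x' , y') =
  (x' ≡ suc x × y' ≡ y) ⊎ (x ≡ suc x' × y ≡ y') ⊎
  (x' ≡ x × y' ≡ suc y) ⊎ (x ≡ x' × y ≡ suc y')

CellStep : List Cell → Cell → Cell → Set
CellStep P c d = c ∈ P × d ∈ P × EdgeAdjacentCells c d

record Polyomino : Set where
  field
    cells     : List Cell
    nonempty  : cells ≢ []
    connected : ∀ {c d} → c ∈ cells → d ∈ cells → Star (CellStep cells) c d

open Polyomino public

-- Convexity: every horizontal and every vertical line meets the polyomino
-- in a connected set, i.e. rows and columns of cells have no gaps.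
IsConvex : Polyomino → Set
IsConvex P =
  (∀ x₁ x₂ x y → (x₁ , y) ∈ cells P → (x₂ , y) ∈ cells P →
     x₁ ≤ x → x ≤ x₂ → (x , y) ∈ cells P) ×
  (∀ x y₁ y₂ y → (x , y₁) ∈ cells P → (x , y₂) ∈ cells P →
     y₁ ≤ y → y ≤ y₂ → (x , y) ∈ cells P)

-- Triangulations: in each cell one of the two diagonals is chosen.
-- true  : the diagonal (x,y)–(x+1,y+1)
-- false : the diagonal (x+1,y)–(x,y+1)

Triangulation : Polyomino → Set
Triangulation P = Cell → Bool

cellEdges : Bool → Cell → List (Point × Point)
cellEdges d (x , y) =
  ((x , y) , (suc x , y)) ∷ ((x , suc y) , (suc x , suc y)) ∷
  ((x , y) , (x , suc y)) ∷ ((suc x , y) , (suc x , suc y)) ∷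
  diag d ∷ []
  where
  diag : Bool → Point × Point
  diag true  = ((x , y) , (suc x , suc y))
  diag false = ((suc x , y) , (x , suc y))

IsVertex : (P : Polyomino) → Point → Set
IsVertex P p = ∃[ c ] (c ∈ cells P × p ∈ corners c)

Adj : (P : Polyomino) → Triangulation P → Point → Point → Set
Adj P t u v = ∃[ c ] (c ∈ cells P × ((u , v) ∈ cellEdges (t c) c ⊎ (v , u) ∈ cellEdges (t c) c))

ThreeColorable : (P : Polyomino) → Triangulation P → Set
ThreeColorable P t =
  Σ (Point → Fin 3) λ col →
    ∀ u v → IsVertex P u → IsVertex P v → Adj P t u v → col u ≢ col v

-- The 3×3 pattern graphs.  Vertex k (0-based label, paper's label k+1)
-- of Fin 9 sits in row ⌊k/3⌋, column k mod 3 (top to bottom, left to right).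

SmallGraph : Set
SmallGraph = List (Fin 9 × Fin 9)

SAdj : SmallGraph → Fin 9 → Fin 9 → Set
SAdj E i j = (i , j) ∈ E ⊎ (j , i) ∈ E

gridEdges : SmallGraph
gridEdges =
  (# 0 , # 1) ∷ (# 1 , # 2) ∷ (# 3 , # 4) ∷ (# 4 , # 5) ∷ (# 6 , # 7) ∷ (# 7 , # 8) ∷
  (# 0 , # 3) ∷ (# 3 , # 6) ∷ (# 1 , # 4) ∷ (# 4 , # 7) ∷ (# 2 , # 5) ∷ (# 5 , # 8) ∷ []

-- T₁: extra diagonals {5,7},{2,4},{6,8},{2,6} (paper labels)
T₁ : SmallGraph
T₁ = (# 4 , # 6) ∷ (# 1 , # 3) ∷ (# 5 , # 7) ∷ (# 1 , # 5) ∷ gridEdges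

-- T₂: extra diagonals {4,8},{1,5},{5,9},{3,5} (paper labels)
T₂ : SmallGraph
T₂ = (# 3 , # 7) ∷ (# 0 , # 4) ∷ (# 4 , # 8) ∷ (# 2 , # 4) ∷ gridEdges

-- Rotation of the drawing by 90° clockwise: (row r, col c) ↦ (row c, col 2-r).
rot : Fin 9 → Fin 9
rot k = lookup9 k
  where
  lookup9 : Fin 9 → Fin 9
  lookup9 Fin.zero = # 2
  lookup9 (Fin.suc Fin.zero) = # 5
  lookup9 (Fin.suc (Fin.suc Fin.zero)) = # 8
  lookup9 (Fin.suc (Fin.suc (Fin.suc Fin.zero))) = # 1
  lookup9 (Fin.suc (Fin.suc (Fin.suc (Fin.suc Fin.zero)))) = # 4
  lookup9 (Fin.suc (Fin.suc (Fin.suc (Fin.suc (Fin.suc Fin.zero))))) = # 7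
  lookup9 (Fin.suc (Fin.suc (Fin.suc (Fin.suc (Fin.suc (Fin.suc Fin.zero)))))) = # 0
  lookup9 (Fin.suc (Fin.suc (Fin.suc (Fin.suc (Fin.suc (Fin.suc (Fin.suc Fin.zero))))))) = # 3
  lookup9 (Fin.suc (Fin.suc (Fin.suc (Fin.suc (Fin.suc (Fin.suc (Fin.suc (Fin.suc Fin.zero)))))))) = # 6

rotate : SmallGraph → SmallGraph
rotate = map (λ { (a , b) → (rot a , rot b) })

rotateN : ℕ → SmallGraph → SmallGraph
rotateN zero    E = E
rotateN (suc n) E = rotate (rotateN n E)

S : Fin 2 → Fin 4 → SmallGraph
S Fin.zero    k = rotateN (Data.Fin.toℕ k) T₁
S (Fin.suc _) k = rotateN (Data.Fin.toℕ k) T₂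

ContainsInduced : (P : Polyomino) → Triangulation P → SmallGraph → Set
ContainsInduced P t H =
  Σ (Fin 9 → Point) λ φ →
    Injective _≡_ _≡_ φ × (∀ i → IsVertex P (φ i)) ×
    (∀ i j → SAdj H i j ⇔ Adj P t (φ i) (φ j))

module Submission where

open import Defs
open import Data.Fin using (Fin)
open import Data.Product using (_×_; Σ; ∃-syntax)
open import Relation.Nullary using (¬_)
open import Function.Bundles using (_⇔_)

-- (⇒) Every graph of S contains an odd wheel (a centre joined to all
--     vertices of a 5- or 7-cycle), and odd wheels are not 3-colourable;
--     a colouring of P would restrict to a colouring of an embedded copy.
-- (⇐) The graph induced on the nine corners of a 2×2 block of cells is
--     determined by the four diagonals, and it lies in S exactly when the
--     diagonals have odd parity.  So if no graph of S occurs, every 2×2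
--     block has even parity: t(x,y) xor t(x,y+1) = t(x+1,y) xor t(x+1,y+1).
--     Using convexity of rows and columns, even parity propagates and
--     forces the form t(x,y) = α x xor β y.  Such a triangulation is
--     coloured by a "potential" in ℤ/3 that changes by ±1 along each unit
--     step, with signs read off from α and β.

open import Data.Bool using (Bool; true; false; not; _xor_)
import Data.Bool as Bool
open import Data.Bool.Properties using (xor-assoc; xor-same; xor-identityʳ)
open import Data.Empty using (⊥-elim)
open import Data.Fin using (zero; suc; #_)
import Data.Fin.Properties as Fin
open import Data.List using (List; []; _∷_; _++_)
open import Data.List.Membership.Propositional using (_∈_; find; lose)
open import Data.List.Membership.Propositional.Properties using (∈-++⁺ˡ; ∈-++⁺ʳ; ∈-++⁻)
import Data.List.Membership.DecPropositional as DecMembership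
open import Data.List.Relation.Unary.All using (All; []; _∷_)
import Data.List.Relation.Unary.All as All
open import Data.List.Relation.Unary.Any using (here; there; any?)
open import Data.Nat using (ℕ; zero; suc; _+_; _∸_; _≤_)
import Data.Nat as ℕ
open import Data.Nat.Properties using (≤-total; m∸n+n≡m; m≤n+m; n≤1+n)
open import Data.Product using (∃; _,_; proj₁; proj₂)
import Data.Product.Properties as Product
open import Data.Sum using (_⊎_; inj₁; inj₂; [_,_]′; swap)
open import Function using (_∘_)
open import Function.Bundles using (mk⇔; Equivalence)
open import Function.Definitions using (Injective)
import Function.Properties.Equivalence as ⇔
open import Relation.Binary.Definitions using (DecidableEquality)
open import Relation.Binary.PropositionalEquality
  using (_≡_; _≢_; refl; sym; trans; cong; subst; ≢-sym; module ≡-Reasoning)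
open import Relation.Nullary using (Dec; yes; no)
open import Relation.Nullary.Decidable
  using (True; toWitness; map′; decidable-stable; _×-dec_; _⊎-dec_; _→-dec_)
open import Relation.Unary using (Decidable)

binary : ∀ {a b d : Fin 2} → a ≢ b → d ≢ b → d ≡ a
binary {zero}     {zero}     a≢b _   = ⊥-elim (a≢b refl)
binary {suc zero} {suc zero} a≢b _   = ⊥-elim (a≢b refl)
binary {zero}     {suc zero} {zero}     _ _   = refl
binary {zero}     {suc zero} {suc zero} _ d≢b = ⊥-elim (d≢b refl)
binary {suc zero} {zero}     {suc zero} _ _   = refl
binary {suc zero} {zero}     {zero}     _ d≢b = ⊥-elim (d≢b refl)

-- Among three colours, the neighbours of c are two-coloured: if a, b, d all
-- avoid c and a, d both avoid b, then d = a.  Removing c (punchOut) reduces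
-- this to 'binary'.
sameColour : ∀ {c a b d : Fin 3} → a ≢ c → b ≢ c → d ≢ c → a ≢ b → d ≢ b → d ≡ a
sameColour a≢c b≢c d≢c a≢b d≢b =
  Fin.punchOut-injective (≢-sym d≢c) (≢-sym a≢c)
    (binary (a≢b ∘ Fin.punchOut-injective (≢-sym a≢c) (≢-sym b≢c))
            (d≢b ∘ Fin.punchOut-injective (≢-sym d≢c) (≢-sym b≢c)))

_≟ₚ_ : DecidableEquality (Fin 9 × Fin 9)
_≟ₚ_ = Product.≡-dec Fin._≟_ Fin._≟_

open DecMembership _≟ₚ_ using (_∈?_)

-- Adjacency in a pattern graph is decidable, so finite facts about the
-- concrete graphs T₁, T₂ and their rotations can be checked by evaluation.
sadj? : ∀ H i j → Dec (SAdj H i j)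
sadj? H i j = ((i , j) ∈? H) ⊎-dec ((j , i) ∈? H)

Proper : SmallGraph → (Fin 9 → Fin 3) → Set
Proper H κ = ∀ i j → SAdj H i j → κ i ≢ κ j

-- A fan around the centre c: a walk r, s₁, u₁, …, sₖ, uₖ of even length
-- whose vertices are all adjacent to c (listed as the pairs (sᵢ , uᵢ)).
Fan : SmallGraph → Fin 9 → Fin 9 → List (Fin 9 × Fin 9) → Set
Fan H c r []             = SAdj H r c
Fan H c r ((s , u) ∷ ps) = SAdj H r c × SAdj H r s × SAdj H s c × SAdj H s u × Fan H c u ps

fan? : ∀ H c r ps → Dec (Fan H c r ps)
fan? H c r []             = sadj? H r c
fan? H c r ((s , u) ∷ ps) =
  sadj? H r c ×-dec sadj? H r s ×-dec sadj? H s c ×-dec sadj? H s u ×-dec fan? H c u ps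

lastOf : Fin 9 → List (Fin 9 × Fin 9) → Fin 9
lastOf r []             = r
lastOf r ((_ , u) ∷ ps) = lastOf u ps

OddWheel : SmallGraph → Fin 9 → Fin 9 → List (Fin 9 × Fin 9) → Set
OddWheel H c r ps = Fan H c r ps × SAdj H (lastOf r ps) r

HasOddWheel : SmallGraph → Set
HasOddWheel H = ∃[ c ] ∃[ r ] ∃[ ps ] OddWheel H c r ps

fan-centre : ∀ {H c} r ps → Fan H c r ps → SAdj H r c
fan-centre r []      rc       = rc
fan-centre r (_ ∷ _) (rc , _) = rc

-- Along a fan, every second vertex has the colour of the first one.
fan-colour : ∀ {H κ} → Proper H κ → ∀ {c} r ps → Fan H c r ps → κ (lastOf r ps) ≡ κ r
fan-colour proper r []             _ = refl
fan-colour proper r ((s , u) ∷ ps) (rc , rs , sc , su , fan) =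
  trans (fan-colour proper u ps fan)
        (sameColour (proper _ _ rc) (proper _ _ sc) (proper _ _ (fan-centre u ps fan))
                    (proper _ _ rs) (≢-sym (proper _ _ su)))

-- Hence the closing edge of an odd wheel joins two vertices of equal colour.
oddWheel-not-3-colourable : ∀ {H κ} → HasOddWheel H → ¬ Proper H κ
oddWheel-not-3-colourable (_ , r , ps , fan , closing) proper =
  proper _ _ closing (fan-colour proper r ps fan)

oddWheel : ∀ {H} c r ps → {True (fan? H c r ps ×-dec sadj? H (lastOf r ps) r)} → HasOddWheel H
oddWheel c r ps {ok} = c , r , ps , toWitness ok

-- Each graph of S has the centre 4 and a rim which is a 5-cycle (rotations
-- of T₁) or a 7-cycle (rotations of T₂).
S-has-odd-wheel : ∀ a k → HasOddWheel (S a k)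
S-has-odd-wheel zero       zero                   = oddWheel (# 4) (# 1) ((# 3 , # 6) ∷ (# 7 , # 5) ∷ [])
S-has-odd-wheel zero       (suc zero)             = oddWheel (# 4) (# 0) ((# 3 , # 7) ∷ (# 5 , # 1) ∷ [])
S-has-odd-wheel zero       (suc (suc zero))       = oddWheel (# 4) (# 1) ((# 3 , # 7) ∷ (# 5 , # 2) ∷ [])
S-has-odd-wheel zero       (suc (suc (suc zero))) = oddWheel (# 4) (# 1) ((# 5 , # 8) ∷ (# 7 , # 3) ∷ [])
S-has-odd-wheel (suc zero) zero                   = oddWheel (# 4) (# 0) ((# 1 , # 2) ∷ (# 5 , # 8) ∷ (# 7 , # 3) ∷ [])
S-has-odd-wheel (suc zero) (suc zero)             = oddWheel (# 4) (# 1) ((# 3 , # 6) ∷ (# 7 , # 8) ∷ (# 5 , # 2) ∷ [])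
S-has-odd-wheel (suc zero) (suc (suc zero))       = oddWheel (# 4) (# 0) ((# 1 , # 5) ∷ (# 8 , # 7) ∷ (# 6 , # 3) ∷ [])
S-has-odd-wheel (suc zero) (suc (suc (suc zero))) = oddWheel (# 4) (# 0) ((# 1 , # 2) ∷ (# 5 , # 7) ∷ (# 6 , # 3) ∷ [])

cellDiagonal : Bool → (sw se nw ne : Fin 9) → Fin 9 × Fin 9
cellDiagonal true  sw se nw ne = (sw , ne)
cellDiagonal false sw se nw ne = (se , nw)

diagonals : (b₀₀ b₁₀ b₀₁ b₁₁ : Bool) → SmallGraph
diagonals b₀₀ b₁₀ b₀₁ b₁₁ =
  cellDiagonal b₀₀ (# 6) (# 7) (# 3) (# 4) ∷ cellDiagonal b₁₀ (# 7) (# 8) (# 4) (# 5) ∷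
  cellDiagonal b₀₁ (# 3) (# 4) (# 0) (# 1) ∷ cellDiagonal b₁₁ (# 4) (# 5) (# 1) (# 2) ∷ []

blockGraph : (b₀₀ b₁₀ b₀₁ b₁₁ : Bool) → SmallGraph
blockGraph b₀₀ b₁₀ b₀₁ b₁₁ = gridEdges ++ diagonals b₀₀ b₁₀ b₀₁ b₁₁

SameGraph : SmallGraph → SmallGraph → Set
SameGraph G H = ∀ i j → SAdj G i j ⇔ SAdj H i j

sameGraph? : ∀ G H → Dec (SameGraph G H)
sameGraph? G H = Fin.all? λ i → Fin.all? λ j → iff? (sadj? G i j) (sadj? H i j)
  where
  iff? : ∀ {A B : Set} → Dec A → Dec B → Dec (A ⇔ B)
  iff? a? b? = map′ (λ (f , g) → mk⇔ f g) (λ e → Equivalence.to e , Equivalence.from e)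
                    ((a? →-dec b?) ×-dec (b? →-dec a?))

InS : SmallGraph → Set
InS G = ∃[ a ] ∃[ k ] SameGraph (S a k) G

inS : ∀ {G} a k → {True (sameGraph? (S a k) G)} → InS G
inS a k {same} = a , k , toWitness same

oddBlock-in-S : ∀ b₀₀ b₁₀ b₀₁ b₁₁ → b₀₀ xor b₀₁ ≢ b₁₀ xor b₁₁ → InS (blockGraph b₀₀ b₁₀ b₀₁ b₁₁)
oddBlock-in-S true  true  true  true  even = ⊥-elim (even refl)
oddBlock-in-S true  true  true  false _    = inS (# 0) (# 0)
oddBlock-in-S true  true  false true  _    = inS (# 1) (# 3)
oddBlock-in-S true  true  false false even = ⊥-elim (even refl)
oddBlock-in-S true  false true  true  _    = inS (# 1) (# 1)
oddBlock-in-S true  false true  false even = ⊥-elim (even refl)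
oddBlock-in-S true  false false true  even = ⊥-elim (even refl)
oddBlock-in-S true  false false false _    = inS (# 1) (# 2)
oddBlock-in-S false true  true  true  _    = inS (# 0) (# 2)
oddBlock-in-S false true  true  false even = ⊥-elim (even refl)
oddBlock-in-S false true  false true  even = ⊥-elim (even refl)
oddBlock-in-S false true  false false _    = inS (# 0) (# 1)
oddBlock-in-S false false true  true  even = ⊥-elim (even refl)
oddBlock-in-S false false true  false _    = inS (# 0) (# 3)
oddBlock-in-S false false false true  _    = inS (# 1) (# 0)
oddBlock-in-S false false false false even = ⊥-elim (even refl)

-- Matching on this view turns geometric statements about
-- the nine corners into finite case analyses.
data Corner (x y : ℕ) : Fin 9 → Point → Set where
  c₀ : Corner x y (# 0) (x , suc (suc y))
  c₁ : Corner x y (# 1) (suc x , suc (suc y))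
  c₂ : Corner x y (# 2) (suc (suc x) , suc (suc y))
  c₃ : Corner x y (# 3) (x , suc y)
  c₄ : Corner x y (# 4) (suc x , suc y)
  c₅ : Corner x y (# 5) (suc (suc x) , suc y)
  c₆ : Corner x y (# 6) (x , y)
  c₇ : Corner x y (# 7) (suc x , y)
  c₈ : Corner x y (# 8) (suc (suc x) , y)

cornerOf : ∀ x y i → ∃ (Corner x y i)
cornerOf x y zero                                                     = _ , c₀
cornerOf x y (suc zero)                                               = _ , c₁
cornerOf x y (suc (suc zero))                                         = _ , c₂
cornerOf x y (suc (suc (suc zero)))                                   = _ , c₃
cornerOf x y (suc (suc (suc (suc zero))))                             = _ , c₄
cornerOf x y (suc (suc (suc (suc (suc zero)))))                       = _ , c₅
cornerOf x y (suc (suc (suc (suc (suc (suc zero))))))                 = _ , c₆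
cornerOf x y (suc (suc (suc (suc (suc (suc (suc zero)))))))           = _ , c₇
cornerOf x y (suc (suc (suc (suc (suc (suc (suc (suc zero)))))))) = _ , c₈

corner : ℕ → ℕ → Fin 9 → Point
corner x y i = proj₁ (cornerOf x y i)

corner-label : ∀ {x y i j u} → Corner x y i u → Corner x y j u → i ≡ j
corner-label c₀ c₀ = refl
corner-label c₁ c₁ = refl
corner-label c₂ c₂ = refl
corner-label c₃ c₃ = refl
corner-label c₄ c₄ = refl
corner-label c₅ c₅ = refl
corner-label c₆ c₆ = refl
corner-label c₇ c₇ = refl
corner-label c₈ c₈ = refl

module Triangulated (P : Polyomino) (t : Triangulation P) where

  data Edge : Point → Point → Set where
    horizontal   : ∀ {x y} → Edge (x , y) (suc x , y)
    vertical     : ∀ {x y} → Edge (x , y) (x , suc y)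
    diagonal     : ∀ {x y} → (x , y) ∈ cells P → t (x , y) ≡ true  → Edge (x , y) (suc x , suc y)
    antidiagonal : ∀ {x y} → (x , y) ∈ cells P → t (x , y) ≡ false → Edge (suc x , y) (x , suc y)

  cellEdge→Edge : ∀ {c u v} → c ∈ cells P → (u , v) ∈ cellEdges (t c) c → Edge u v
  cellEdge→Edge {c} c∈P = classify (t c) refl
    where
    classify : ∀ {u v} d → t c ≡ d → (u , v) ∈ cellEdges d c → Edge u v
    classify d     _  (here refl)                                 = horizontal
    classify d     _  (there (here refl))                         = horizontal
    classify d     _  (there (there (here refl)))                 = vertical
    classify d     _  (there (there (there (here refl))))         = vertical
    classify true  tc (there (there (there (there (here refl))))) = diagonal c∈P tc
    classify false tc (there (there (there (there (here refl))))) = antidiagonal c∈P tc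

  Adj→Edge : ∀ {u v} → Adj P t u v → Edge u v ⊎ Edge v u
  Adj→Edge (c , c∈P , inj₁ uv) = inj₁ (cellEdge→Edge c∈P uv)
  Adj→Edge (c , c∈P , inj₂ vu) = inj₂ (cellEdge→Edge c∈P vu)

  Adj-sym : ∀ {u v} → Adj P t u v → Adj P t v u
  Adj-sym (c , c∈P , uv) = c , c∈P , swap uv

  module _ {x y : ℕ} (c∈P : (x , y) ∈ cells P) where
    bottomSide : Adj P t (x , y) (suc x , y)
    bottomSide = _ , c∈P , inj₁ (here refl)

    topSide : Adj P t (x , suc y) (suc x , suc y)
    topSide = _ , c∈P , inj₁ (there (here refl))

    leftSide : Adj P t (x , y) (x , suc y)
    leftSide = _ , c∈P , inj₁ (there (there (here refl)))

    rightSide : Adj P t (suc x , y) (suc x , suc y)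
    rightSide = _ , c∈P , inj₁ (there (there (there (here refl))))

    mainDiagonal : t (x , y) ≡ true → Adj P t (x , y) (suc x , suc y)
    mainDiagonal tc =
      _ , c∈P , inj₁ (subst (λ d → _ ∈ cellEdges d _) (sym tc) (there (there (there (there (here refl))))))

    antiDiagonal : t (x , y) ≡ false → Adj P t (suc x , y) (x , suc y)
    antiDiagonal tc =
      _ , c∈P , inj₁ (subst (λ d → _ ∈ cellEdges d _) (sym tc) (there (there (there (there (here refl))))))

  record BlockIn (x y : ℕ) : Set where
    field
      sw : (x , y) ∈ cells P
      se : (suc x , y) ∈ cells P
      nw : (x , suc y) ∈ cells P
      ne : (suc x , suc y) ∈ cells P

  blockGraphAt : ℕ → ℕ → SmallGraph
  blockGraphAt x y = blockGraph (t (x , y)) (t (suc x , y)) (t (x , suc y)) (t (suc x , suc y))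

  corner-vertex : ∀ {x y i u} → BlockIn x y → Corner x y i u → IsVertex P u
  corner-vertex B c₀ = _ , BlockIn.nw B , there (there (here refl))
  corner-vertex B c₁ = _ , BlockIn.nw B , there (there (there (here refl)))
  corner-vertex B c₂ = _ , BlockIn.ne B , there (there (there (here refl)))
  corner-vertex B c₃ = _ , BlockIn.sw B , there (there (here refl))
  corner-vertex B c₄ = _ , BlockIn.sw B , there (there (there (here refl)))
  corner-vertex B c₅ = _ , BlockIn.se B , there (there (there (here refl)))
  corner-vertex B c₆ = _ , BlockIn.sw B , here refl
  corner-vertex B c₇ = _ , BlockIn.sw B , there (here refl)
  corner-vertex B c₈ = _ , BlockIn.se B , there (here refl)

  private
    gridEdge : ∀ {i j b₀₀ b₁₀ b₀₁ b₁₁} {ok : True ((i , j) ∈? gridEdges)} →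
               (i , j) ∈ blockGraph b₀₀ b₁₀ b₀₁ b₁₁
    gridEdge {ok = ok} = ∈-++⁺ˡ (toWitness ok)

    mainChosen : ∀ {b sw se nw ne} → b ≡ true → (sw , ne) ≡ cellDiagonal b sw se nw ne
    mainChosen refl = refl

    antiChosen : ∀ {b sw se nw ne} → b ≡ false → (se , nw) ≡ cellDiagonal b sw se nw ne
    antiChosen refl = refl

  -- An edge between two corners of a block is an edge of its block graph.
  -- (Edges leaving the block need no clause: no corner matches their end.)
  edge→block : ∀ {x y i j u v} → Corner x y i u → Edge u v → Corner x y j v → SAdj (blockGraphAt x y) i j
  edge→block c₀ horizontal c₁ = inj₁ gridEdge
  edge→block c₁ horizontal c₂ = inj₁ gridEdge
  edge→block c₃ horizontal c₄ = inj₁ gridEdge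
  edge→block c₄ horizontal c₅ = inj₁ gridEdge
  edge→block c₆ horizontal c₇ = inj₁ gridEdge
  edge→block c₇ horizontal c₈ = inj₁ gridEdge
  edge→block c₃ vertical   c₀ = inj₂ gridEdge
  edge→block c₄ vertical   c₁ = inj₂ gridEdge
  edge→block c₅ vertical   c₂ = inj₂ gridEdge
  edge→block c₆ vertical   c₃ = inj₂ gridEdge
  edge→block c₇ vertical   c₄ = inj₂ gridEdge
  edge→block c₈ vertical   c₅ = inj₂ gridEdge
  edge→block c₆ (diagonal _ tc) c₄ = inj₁ (∈-++⁺ʳ gridEdges (here (mainChosen tc)))
  edge→block c₇ (diagonal _ tc) c₅ = inj₁ (∈-++⁺ʳ gridEdges (there (here (mainChosen tc))))
  edge→block c₃ (diagonal _ tc) c₁ = inj₁ (∈-++⁺ʳ gridEdges (there (there (here (mainChosen tc)))))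
  edge→block c₄ (diagonal _ tc) c₂ = inj₁ (∈-++⁺ʳ gridEdges (there (there (there (here (mainChosen tc))))))
  edge→block c₇ (antidiagonal _ tc) c₃ = inj₁ (∈-++⁺ʳ gridEdges (here (antiChosen tc)))
  edge→block c₈ (antidiagonal _ tc) c₄ = inj₁ (∈-++⁺ʳ gridEdges (there (here (antiChosen tc))))
  edge→block c₄ (antidiagonal _ tc) c₀ = inj₁ (∈-++⁺ʳ gridEdges (there (there (here (antiChosen tc)))))
  edge→block c₅ (antidiagonal _ tc) c₁ = inj₁ (∈-++⁺ʳ gridEdges (there (there (there (here (antiChosen tc))))))

  module _ {x y : ℕ} (B : BlockIn x y) where
    open BlockIn B

    JoinedBy : Fin 9 × Fin 9 → Set
    JoinedBy (i , j) = ∀ {u v} → Corner x y i u → Corner x y j v → Adj P t u v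

    gridSides : All JoinedBy gridEdges
    gridSides =
      (λ { c₀ c₁ → topSide nw }) ∷ (λ { c₁ c₂ → topSide ne }) ∷
      (λ { c₃ c₄ → bottomSide nw }) ∷ (λ { c₄ c₅ → bottomSide ne }) ∷
      (λ { c₆ c₇ → bottomSide sw }) ∷ (λ { c₇ c₈ → bottomSide se }) ∷
      (λ { c₀ c₃ → Adj-sym (leftSide nw) }) ∷ (λ { c₃ c₆ → Adj-sym (leftSide sw) }) ∷
      (λ { c₁ c₄ → Adj-sym (rightSide nw) }) ∷ (λ { c₄ c₇ → Adj-sym (rightSide sw) }) ∷
      (λ { c₂ c₅ → Adj-sym (rightSide ne) }) ∷ (λ { c₅ c₈ → Adj-sym (rightSide se) }) ∷ []

    chosenDiagonals : All JoinedBy (diagonals (t (x , y)) (t (suc x , y)) (t (x , suc y)) (t (suc x , suc y)))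
    chosenDiagonals = cell₀₀ refl ∷ cell₁₀ refl ∷ cell₀₁ refl ∷ cell₁₁ refl ∷ []
      where
      cell₀₀ : ∀ {b} → t (x , y) ≡ b → JoinedBy (cellDiagonal b (# 6) (# 7) (# 3) (# 4))
      cell₀₀ {true}  tc c₆ c₄ = mainDiagonal sw tc
      cell₀₀ {false} tc c₇ c₃ = antiDiagonal sw tc
      cell₁₀ : ∀ {b} → t (suc x , y) ≡ b → JoinedBy (cellDiagonal b (# 7) (# 8) (# 4) (# 5))
      cell₁₀ {true}  tc c₇ c₅ = mainDiagonal se tc
      cell₁₀ {false} tc c₈ c₄ = antiDiagonal se tc
      cell₀₁ : ∀ {b} → t (x , suc y) ≡ b → JoinedBy (cellDiagonal b (# 3) (# 4) (# 0) (# 1))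
      cell₀₁ {true}  tc c₃ c₁ = mainDiagonal nw tc
      cell₀₁ {false} tc c₄ c₀ = antiDiagonal nw tc
      cell₁₁ : ∀ {b} → t (suc x , suc y) ≡ b → JoinedBy (cellDiagonal b (# 4) (# 5) (# 1) (# 2))
      cell₁₁ {true}  tc c₄ c₂ = mainDiagonal ne tc
      cell₁₁ {false} tc c₅ c₁ = antiDiagonal ne tc

    block→Adj : ∀ {i j} → (i , j) ∈ blockGraphAt x y → JoinedBy (i , j)
    block→Adj e = [ All.lookup gridSides , All.lookup chosenDiagonals ]′ (∈-++⁻ gridEdges e)

    cornerView : ∀ i → Corner x y i (corner x y i)
    cornerView i = proj₂ (cornerOf x y i)

    block-induced : ∀ i j → SAdj (blockGraphAt x y) i j ⇔ Adj P t (corner x y i) (corner x y j)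
    block-induced i j = mk⇔ to from
      where
      to : SAdj (blockGraphAt x y) i j → Adj P t (corner x y i) (corner x y j)
      to (inj₁ ij) = block→Adj ij (cornerView i) (cornerView j)
      to (inj₂ ji) = Adj-sym (block→Adj ji (cornerView j) (cornerView i))
      from : Adj P t (corner x y i) (corner x y j) → SAdj (blockGraphAt x y) i j
      from adj with Adj→Edge adj
      ... | inj₁ e = edge→block (cornerView i) e (cornerView j)
      ... | inj₂ e = swap (edge→block (cornerView j) e (cornerView i))

    block-contains : InS (blockGraphAt x y) → ∃[ a ] ∃[ k ] ContainsInduced P t (S a k)
    block-contains (a , k , same) =
      a , k , corner x y , injective , (λ i → corner-vertex B (cornerView i)) ,
      λ i j → ⇔.trans (same i j) (block-induced i j)
      where
      injective : Injective _≡_ _≡_ (corner x y)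
      injective {i} {j} eq = corner-label (cornerView i) (subst (Corner x y j) (sym eq) (cornerView j))

  S-free⇒even : ¬ (∃[ a ] ∃[ k ] ContainsInduced P t (S a k)) → ∀ {x y} → BlockIn x y →
                t (x , y) xor t (x , suc y) ≡ t (suc x , y) xor t (suc x , suc y)
  S-free⇒even S-free B =
    decidable-stable (_ Bool.≟ _) λ odd → S-free (block-contains B (oddBlock-in-S _ _ _ _ odd))

module _ {B : Set} (A : ℕ → Set) (convex : ∀ {i j k} → A i → A k → i ≤ j → j ≤ k → A j)
         (f : ℕ → B) (step : ∀ {i} → A i → A (suc i) → f i ≡ f (suc i)) where

  private
    upward : ∀ d {i} → A i → A (d + i) → f i ≡ f (d + i)
    upward zero    _  _  = refl
    upward (suc d) {i} ai ad = trans (upward d ai ad′) (step ad′ ad)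
      where ad′ = convex ai ad (m≤n+m i d) (n≤1+n (d + i))

    ordered : ∀ {i j} → i ≤ j → A i → A j → f i ≡ f j
    ordered {i} {j} i≤j ai aj =
      trans (upward (j ∸ i) ai (subst A (sym (m∸n+n≡m i≤j)) aj)) (cong f (m∸n+n≡m i≤j))

  constant-on-interval : ∀ {i j} → A i → A j → f i ≡ f j
  constant-on-interval {i} {j} ai aj with ≤-total i j
  ... | inj₁ i≤j = ordered i≤j ai aj
  ... | inj₂ j≤i = sym (ordered j≤i aj ai)

-- If f takes a single value on the members of xs satisfying a decidable Q,
-- that value can be found by searching xs (any value will do if none exist).
commonValue : ∀ {A : Set} (xs : List A) {Q : A → Set} → Decidable Q → (f : A → Bool) →
              (∀ {c d} → c ∈ xs → d ∈ xs → Q c → Q d → f c ≡ f d) →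
              Σ Bool λ v → ∀ {c} → c ∈ xs → Q c → f c ≡ v
commonValue xs Q? f same with any? Q? xs
... | no none = false , λ c∈xs qc → ⊥-elim (none (lose c∈xs qc))
... | yes found with find found
...   | w , w∈xs , qw = f w , λ c∈xs qc → same c∈xs w∈xs qc qw

xor-telescope : ∀ p q r → q xor (r xor (p xor q)) ≡ p xor r
xor-telescope false false false = refl
xor-telescope false false true  = refl
xor-telescope false true  false = refl
xor-telescope false true  true  = refl
xor-telescope true  false false = refl
xor-telescope true  false true  = refl
xor-telescope true  true  false = refl
xor-telescope true  true  true  = refl

xor-unshift : ∀ {p q r} → p xor q ≡ r → p ≡ r xor q
xor-unshift {p} {q} {r} pq≡r = begin
  p                ≡⟨ sym (xor-identityʳ p) ⟩
  p xor false      ≡⟨ cong (p xor_) (sym (xor-same q)) ⟩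
  p xor (q xor q)  ≡⟨ sym (xor-assoc p q q) ⟩
  (p xor q) xor q  ≡⟨ cong (_xor q) pq≡r ⟩
  r xor q          ∎
  where open ≡-Reasoning

open DecMembership (Product.≡-dec ℕ._≟_ ℕ._≟_) using () renaming (_∈?_ to _∈ᶜ?_)

module Split (P : Polyomino) (t : Triangulation P) (convex : IsConvex P) where
  open Triangulated P t

  rowChange : ℕ → ℕ → Bool
  rowChange x y = t (x , y) xor t (x , suc y)

  module _ (even : ∀ {x y} → BlockIn x y → rowChange x y ≡ rowChange (suc x) y) where

    Straddles : ℕ → ℕ → Set
    Straddles y x = (x , y) ∈ cells P × (x , suc y) ∈ cells P

    -- By row convexity, the change between two rows is the same in every column.
    rowChange-constant : ∀ {x x′ y} → Straddles y x → Straddles y x′ → rowChange x y ≡ rowChange x′ y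
    rowChange-constant {y = y} = constant-on-interval (Straddles y) straddles-convex (λ x → rowChange x y)
      λ (sw , nw) (se , ne) → even (record { sw = sw ; se = se ; nw = nw ; ne = ne })
      where
      straddles-convex : ∀ {i j k} → Straddles y i → Straddles y k → i ≤ j → j ≤ k → Straddles y j
      straddles-convex (i₀ , i₁) (k₀ , k₁) i≤j j≤k =
        proj₁ convex _ _ _ y i₀ k₀ i≤j j≤k , proj₁ convex _ _ _ (suc y) i₁ k₁ i≤j j≤k

    rowChangeAt : ∀ y → Σ Bool λ v → ∀ {c} → c ∈ cells P → (proj₂ c ≡ y × (proj₁ c , suc y) ∈ cells P) →
                  rowChange (proj₁ c) y ≡ v
    rowChangeAt y = commonValue (cells P) (λ (x , y′) → (y′ ℕ.≟ y) ×-dec ((x , suc y) ∈ᶜ? cells P))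
      (λ c → rowChange (proj₁ c) y)
      λ { c∈P d∈P (refl , c′∈P) (refl , d′∈P) → rowChange-constant (c∈P , c′∈P) (d∈P , d′∈P) }

    β : ℕ → Bool
    β zero    = false
    β (suc y) = β y xor proj₁ (rowChangeAt y)

    columnValue : ℕ → ℕ → Bool
    columnValue x y = t (x , y) xor β y

    -- By column convexity, t (x , y) xor β y does not depend on y.
    columnValue-constant : ∀ {x y y′} → (x , y) ∈ cells P → (x , y′) ∈ cells P → columnValue x y ≡ columnValue x y′
    columnValue-constant {x} = constant-on-interval (λ y → (x , y) ∈ cells P)
      (λ i∈P k∈P i≤j j≤k → proj₂ convex x _ _ _ i∈P k∈P i≤j j≤k) (columnValue x) step
      where
      step : ∀ {y} → (x , y) ∈ cells P → (x , suc y) ∈ cells P → columnValue x y ≡ columnValue x (suc y)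
      step {y} low high = begin
        t (x , y) xor β y                             ≡⟨ sym (xor-telescope (t (x , y)) (t (x , suc y)) (β y)) ⟩
        t (x , suc y) xor (β y xor rowChange x y)     ≡⟨ cong (λ r → t (x , suc y) xor (β y xor r))
                                                              (proj₂ (rowChangeAt y) low (refl , high)) ⟩
        t (x , suc y) xor β (suc y)                   ∎
        where open ≡-Reasoning

    columnValueAt : ∀ x → Σ Bool λ v → ∀ {c} → c ∈ cells P → proj₁ c ≡ x → columnValue (proj₁ c) (proj₂ c) ≡ v
    columnValueAt x = commonValue (cells P) (λ c → proj₁ c ℕ.≟ x) (λ c → columnValue (proj₁ c) (proj₂ c))
      λ { c∈P d∈P refl refl → columnValue-constant c∈P d∈P }

    α : ℕ → Bool
    α x = proj₁ (columnValueAt x)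

    split : ∀ {x y} → (x , y) ∈ cells P → t (x , y) ≡ α x xor β y
    split c∈P = xor-unshift (proj₂ (columnValueAt _) c∈P refl)

pattern one = suc zero
pattern two = suc (suc zero)

-- ℤ/3 on Fin 3, with addition generated by the successor 'next'.
next : Fin 3 → Fin 3
next zero = one
next one  = two
next two  = zero

infixl 6 _⊕_
_⊕_ : Fin 3 → Fin 3 → Fin 3
zero ⊕ b = b
one  ⊕ b = next b
two  ⊕ b = next (next b)

next³ : ∀ a → next (next (next a)) ≡ a
next³ zero = refl
next³ one  = refl
next³ two  = refl

next-injective : ∀ {a b} → next a ≡ next b → a ≡ b
next-injective {a} {b} eq = trans (sym (next³ a)) (trans (cong (next ∘ next) eq) (next³ b))

⊕-identityʳ : ∀ a → a ⊕ zero ≡ a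
⊕-identityʳ zero = refl
⊕-identityʳ one  = refl
⊕-identityʳ two  = refl

⊕-nextˡ : ∀ a b → next a ⊕ b ≡ next (a ⊕ b)
⊕-nextˡ zero b = refl
⊕-nextˡ one  b = refl
⊕-nextˡ two  b = sym (next³ b)

⊕-nextʳ : ∀ a b → a ⊕ next b ≡ next (a ⊕ b)
⊕-nextʳ zero b = refl
⊕-nextʳ one  b = refl
⊕-nextʳ two  b = refl

⊕-comm : ∀ a b → a ⊕ b ≡ b ⊕ a
⊕-comm a zero = ⊕-identityʳ a
⊕-comm a one  = trans (⊕-nextʳ a zero) (cong next (⊕-identityʳ a))
⊕-comm a two  = trans (⊕-nextʳ a one) (cong next (⊕-comm a one))

⊕-assoc : ∀ a b c → a ⊕ b ⊕ c ≡ a ⊕ (b ⊕ c)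
⊕-assoc zero b c = refl
⊕-assoc one  b c = ⊕-nextˡ b c
⊕-assoc two  b c = trans (⊕-nextˡ (next b) c) (cong next (⊕-nextˡ b c))

⊕-cancelˡ : ∀ a {u v} → a ⊕ u ≡ a ⊕ v → u ≡ v
⊕-cancelˡ zero eq = eq
⊕-cancelˡ one  eq = next-injective eq
⊕-cancelˡ two  eq = next-injective (next-injective eq)

shift-≢ : ∀ {s} → s ≢ zero → ∀ {c} → c ≢ c ⊕ s
shift-≢ s≢0 {c} eq = s≢0 (sym (⊕-cancelˡ c (trans (⊕-identityʳ c) eq)))

-- The units ±1 of ℤ/3, selected by a bit.
unit : Bool → Fin 3
unit true  = one
unit false = two

unit-nonzero : ∀ p → unit p ≢ zero
unit-nonzero true  ()
unit-nonzero false ()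

-- The two sign facts behind the diagonals: −1 and +1 steps never cancel
-- along a main diagonal, nor agree across an anti-diagonal.
diagonal-unit : ∀ p q → p xor q ≡ true → unit (not q) ⊕ unit p ≢ zero
diagonal-unit true  false _ ()
diagonal-unit false true  _ ()

antidiagonal-unit : ∀ p q → p xor q ≡ false → unit p ≢ unit (not q)
antidiagonal-unit true  true  _ ()
antidiagonal-unit false false _ ()

height : (ℕ → Bool) → ℕ → Fin 3
height s zero    = zero
height s (suc n) = height s n ⊕ unit (s n)

module Colouring (P : Polyomino) (t : Triangulation P) (α β : ℕ → Bool)
                 (split : ∀ {x y} → (x , y) ∈ cells P → t (x , y) ≡ α x xor β y) where
  open Triangulated P t

  potential : Point → Fin 3
  potential (x , y) = height α x ⊕ height (not ∘ β) y

  right : ∀ x y → potential (suc x , y) ≡ potential (x , y) ⊕ unit (α x)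
  right x y = begin
    height α x ⊕ unit (α x) ⊕ Y    ≡⟨ ⊕-assoc (height α x) _ Y ⟩
    height α x ⊕ (unit (α x) ⊕ Y)  ≡⟨ cong (height α x ⊕_) (⊕-comm (unit (α x)) Y) ⟩
    height α x ⊕ (Y ⊕ unit (α x))  ≡⟨ sym (⊕-assoc (height α x) Y _) ⟩
    height α x ⊕ Y ⊕ unit (α x)    ∎
    where
    open ≡-Reasoning
    Y = height (not ∘ β) y

  up : ∀ x y → potential (x , suc y) ≡ potential (x , y) ⊕ unit (not (β y))
  up x y = sym (⊕-assoc (height α x) (height (not ∘ β) y) _)

  edge-colours : ∀ {u v} → Edge u v → potential u ≢ potential v
  edge-colours (horizontal {x} {y}) eq = shift-≢ (unit-nonzero (α x)) (trans eq (right x y))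
  edge-colours (vertical {x} {y})   eq = shift-≢ (unit-nonzero (not (β y))) (trans eq (up x y))
  edge-colours (diagonal {x} {y} c∈P tc) eq =
    shift-≢ (diagonal-unit (α x) (β y) (trans (sym (split c∈P)) tc)) (trans eq twoSteps)
    where
    open ≡-Reasoning
    twoSteps : potential (suc x , suc y) ≡ potential (x , y) ⊕ (unit (not (β y)) ⊕ unit (α x))
    twoSteps = begin
      potential (suc x , suc y)                           ≡⟨ right x (suc y) ⟩
      potential (x , suc y) ⊕ unit (α x)                  ≡⟨ cong (_⊕ unit (α x)) (up x y) ⟩
      potential (x , y) ⊕ unit (not (β y)) ⊕ unit (α x)   ≡⟨ ⊕-assoc (potential (x , y)) _ _ ⟩
      potential (x , y) ⊕ (unit (not (β y)) ⊕ unit (α x)) ∎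
  edge-colours (antidiagonal {x} {y} c∈P tc) eq =
    antidiagonal-unit (α x) (β y) (trans (sym (split c∈P)) tc)
      (⊕-cancelˡ (potential (x , y)) (trans (sym (right x y)) (trans eq (up x y))))

  three-colourable : ThreeColorable P t
  three-colourable = potential , proper
    where
    proper : ∀ u v → IsVertex P u → IsVertex P v → Adj P t u v → potential u ≢ potential v
    proper u v _ _ adj with Adj→Edge adj
    ... | inj₁ e = edge-colours e
    ... | inj₂ e = ≢-sym (edge-colours e)

-- A 3-colouring of P restricts to every induced copy of a graph of S,
-- which is impossible because of its odd wheel.
colourable⇒S-free : ∀ P t → ThreeColorable P t → ¬ (∃[ a ] ∃[ k ] ContainsInduced P t (S a k))
colourable⇒S-free P t (κ , proper) (a , k , φ , _ , vertex , induced) =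
  oddWheel-not-3-colourable (S-has-odd-wheel a k)
    λ i j ij → proper (φ i) (φ j) (vertex i) (vertex j) (Equivalence.to (induced i j) ij)

lemma7 : (P : Polyomino) → IsConvex P → (t : Triangulation P) →
    ThreeColorable P t ⇔ (¬ (∃[ a ] ∃[ k ] ContainsInduced P t (S a k)))
lemma7 P convex t = mk⇔ (colourable⇒S-free P t) λ S-free →
  let even = Triangulated.S-free⇒even P t S-free
      open Split P t convex
  in Colouring.three-colourable P t (α even) (β even) (split even)
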